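{- For any bridge $w$, $|\{z\in\mathcal{M}_4(T)\mid z^{(1)}=w\}|\le |K(w)|\,(|K(w)|-1)$.
   Context: $\Sigma$ is an ordered alphabet, $\$\notin\Sigma$, and $T$ is a string of length $n\ge3$ with $T[1]=T[n]=\$$ and $T[2..n-1]\in\Sigma^*$. For a string $w$, $R(w)$ is the number of maximal runs of equal characters in $w$. A string $w\in(\Sigma\cup\{\$\})^*$ with $|w|\ge2$ is a bridge if $w[1]\neq w[2]$ and $w[|w|-1]\neq w[|w|]$ (its first and last runs have length 1); $\mathcal{B}$ is the set of bridges that are substrings of $T$. For a string $w$ with $R(w)\ge3$, $w^{(1)}$ is the bridge obtained from $w$ by deleting its first and last runs and then shortening the (new) first and last runs to length 1; $w^{(1)}=\varepsilon$ if $R(w)\le2$. $K(w)=\{w'\in\mathcal{B}\mid w'^{(1)}=w\}$. A string $w\in\Sigma^*$ is a minimal absent word (MAW) for $T$ if $w$ does not occur in $T$ but every proper substring of $w$ occurs in $T$; writing a MAW of length $\ge2$ as $aub$ ($a,b\in\Sigma$, $u\in\Sigma^*$), $\mathcal{M}_4(T)$ is the set of MAWs with $R(aub)\ge4$, $a\neq u[1]$, $b\neq u[|u|]$. -}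

module Defs where

open import Data.Nat using (ℕ; zero; suc; _≤_; _<_; _≤ᵇ_)
open import Data.Bool using (if_then_else_)
open import Data.List using (List; []; _∷_; _++_; length; map; replicate)
open import Data.List.Relation.Unary.Unique.Propositional using (Unique)
open import Data.List.Membership.Propositional using (_∈_)
open import Data.Product using (_×_; _,_; ∃; ∃-syntax)
open import Relation.Nullary using (¬_; yes; no)
open import Relation.Binary.Definitions using (DecidableEquality)
open import Relation.Binary.PropositionalEquality using (_≡_; _≢_)

data Chr (Σ : Set) : Set where
  $   : Chr Σ
  sym : Σ → Chr Σ

module Strings {Σ : Set} (_≟Σ_ : DecidableEquality Σ) where

  _≟_ : DecidableEquality (Chr Σ)
  $ ≟ $ = yes _≡_.refl
  $ ≟ sym _ = no (λ ())
  sym _ ≟ $ = no (λ ())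
  sym a ≟ sym b with a ≟Σ b
  ... | yes _≡_.refl = yes _≡_.refl
  ... | no ne = no (λ { _≡_.refl → ne _≡_.refl })

  -- run-length encoding: (a , k) is a maximal run of a of length suc k
  data Run : Set where
    run : Chr Σ → ℕ → Run

  rle : List (Chr Σ) → List Run
  rle [] = []
  rle (x ∷ xs) with rle xs
  ... | [] = run x 0 ∷ []
  ... | run y k ∷ rs with x ≟ y
  ...   | yes _ = run y (suc k) ∷ rs
  ...   | no  _ = run x 0 ∷ run y k ∷ rs

  expand : List Run → List (Chr Σ)
  expand [] = []
  expand (run a k ∷ rs) = replicate (suc k) a ++ expand rs

  R : List (Chr Σ) → ℕ
  R w = length (rle w)

  dropLast : {X : Set} → List X → List X
  dropLast [] = []
  dropLast (_ ∷ []) = []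
  dropLast (x ∷ y ∷ xs) = x ∷ dropLast (y ∷ xs)

  setLast1 : List Run → List Run
  setLast1 [] = []
  setLast1 (run a _ ∷ []) = run a 0 ∷ []
  setLast1 (r ∷ r' ∷ rs) = r ∷ setLast1 (r' ∷ rs)

  shorten : List Run → List Run
  shorten [] = []
  shorten (run a _ ∷ []) = run a 0 ∷ []
  shorten (run a _ ∷ r ∷ rs) = run a 0 ∷ setLast1 (r ∷ rs)

  dropFirst : {X : Set} → List X → List X
  dropFirst [] = []
  dropFirst (_ ∷ xs) = xs

  sup1 : List (Chr Σ) → List (Chr Σ)
  sup1 w = if R w ≤ᵇ 2 then [] else expand (shorten (dropLast (dropFirst (rle w))))

  _⊑_ : {X : Set} → List X → List X → Set
  u ⊑ v = ∃[ p ] ∃[ s ] (p ++ u ++ s ≡ v)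

  IsBridge : List (Chr Σ) → Set
  IsBridge w = (2 ≤ length w)
    × (∃[ a ] ∃[ b ] ∃[ u ] (w ≡ a ∷ b ∷ u × a ≢ b))
    × (∃[ u ] ∃[ a ] ∃[ b ] (w ≡ u ++ a ∷ b ∷ [] × a ≢ b))

  text : List Σ → List (Chr Σ)
  text t = $ ∷ map sym t ++ $ ∷ []

  module _ (t : List Σ) where
    Occurs : List Σ → Set
    Occurs u = map sym u ⊑ text t

    InB : List (Chr Σ) → Set
    InB w = IsBridge w × w ⊑ text t

    InK : List (Chr Σ) → List (Chr Σ) → Set
    InK w w' = InB w' × sup1 w' ≡ w

    IsMAW : List Σ → Set
    IsMAW w = ¬ Occurs w × (∀ u → u ⊑ w → length u < length w → Occurs u)

    InM4 : List Σ → Set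
    InM4 z = IsMAW z × (∃[ a ] ∃[ u ] ∃[ b ]
        ( z ≡ a ∷ u ++ b ∷ []
        × 4 ≤ R (map sym z)
        × (∀ c us → u ≡ c ∷ us → a ≢ c)
        × (∀ us c → u ≡ us ++ c ∷ [] → b ≢ c)))

    Enumerates : {X : Set} → List X → (X → Set) → Set
    Enumerates ks P = Unique ks × (∀ x → (x ∈ ks → P x) × (P x → x ∈ ks))

{-# OPTIONS --safe #-}
-- Write z ∈ 𝓜₄ with z⁽¹⁾ = w through its runs as a y^(i+1) m x^(l+1) b. Minimality puts
-- a y^(i+1) m x^(l+1) and y^(i+1) m x^(l+1) b into T; as T begins and ends with $, the last
-- run of the former extends to a maximal one, followed by some c ≠ x, and the first run of the
-- latter to a maximal one, preceded by some d ≠ y. This gives bridges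
-- k₁ = a y^(i+1) m x^(l+j+1) c and k₂ = d y^(i+j′+1) m x^(l+1) b in K(w). The runs of z are
-- those of k₁ with the last two replaced by those of k₂, so z ↦ (k₁, k₂) is injective, and
-- k₁ ≠ k₂ since otherwise z = k₁ would occur in T.
module Submission where

open import Defs
import Algebra.Solver.Monoid as MonoidSolver
open import Data.Nat using (ℕ; zero; suc; _+_; _*_; _∸_; _≤_; z≤n; s≤s)
open import Data.Nat.Properties
  using (≤-refl; ≤-reflexive; ≤-trans; n≤1+n; +-suc; +-comm; *-identityʳ; *-distribˡ-∸; m+n≤o⇒m≤o∸n;
         module ≤-Reasoning)
open import Data.List
  using (List; []; _∷_; _++_; length; map; replicate; reverse; take; drop; cartesianProduct)
open import Data.List.Properties
  using (++-assoc; ++-identityʳ; ++-monoid; map-++; map-injective; ∷-injectiveˡ; ∷-injectiveʳ;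
         ∷ʳ-injectiveˡ; ∷ʳ-injectiveʳ; length-++; length-map; length-++-sucʳ; reverse-++; reverse-involutive)
open import Data.List.Relation.Unary.All as All using (All; []; _∷_)
import Data.List.Relation.Unary.All.Properties as All
open import Data.List.Relation.Unary.Any using (here; there)
open import Data.List.Relation.Unary.Linked as Linked using (Linked; []; [-]; _∷_)
open import Data.List.Relation.Unary.Unique.Propositional using (Unique; []; _∷_)
import Data.List.Relation.Unary.Unique.Propositional.Properties as Unique
open import Data.List.Relation.Binary.Subset.Propositional using (_⊆_)
open import Data.List.Membership.Propositional using (_∈_)
open import Data.List.Membership.Propositional.Properties
  using (∈-∃++; ∈-++⁻; ∈-++⁺ˡ; ∈-++⁺ʳ; ∈-map⁻; ∈-cartesianProduct⁺)
open import Data.Product using (_×_; _,_; proj₁; proj₂; ∃-syntax)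
open import Data.Sum using (_⊎_; inj₁; inj₂)
open import Data.Empty using (⊥-elim)
open import Function using (_∘_; case_of_)
open import Relation.Nullary using (¬_; yes; no)
open import Relation.Binary.Definitions using (DecidableEquality)
open import Relation.Binary.PropositionalEquality
  using (_≡_; _≢_; refl; trans; cong; cong₂; subst; subst₂; module ≡-Reasoning)
  renaming (sym to ≡-sym)

module _ {A B : Set} where

  length-cartesianProduct : (xs : List A) (ys : List B) →
    length (cartesianProduct xs ys) ≡ length xs * length ys
  length-cartesianProduct []       ys = refl
  length-cartesianProduct (x ∷ xs) ys = begin
    length (map (x ,_) ys ++ cartesianProduct xs ys)
      ≡⟨ length-++ (map (x ,_) ys) ⟩
    length (map (x ,_) ys) + length (cartesianProduct xs ys)
      ≡⟨ cong₂ _+_ (length-map (x ,_) ys) (length-cartesianProduct xs ys) ⟩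
    length ys + length xs * length ys ∎
    where
      open ≡-Reasoning

Unique∧⊆⇒length≤ : {A : Set} {xs ys : List A} → Unique xs → xs ⊆ ys → length xs ≤ length ys
Unique∧⊆⇒length≤ {xs = []}     _             _      = z≤n
Unique∧⊆⇒length≤ {xs = x ∷ xs} (x∉xs ∷ !xs) xs⊆ys with ∈-∃++ (xs⊆ys (here refl))
... | ys₁ , ys₂ , refl =
  subst (suc (length xs) ≤_) (≡-sym (length-++-sucʳ ys₁ x ys₂)) (s≤s (Unique∧⊆⇒length≤ !xs xs⊆ys₁++ys₂))
  where
  xs⊆ys₁++ys₂ : xs ⊆ ys₁ ++ ys₂
  xs⊆ys₁++ys₂ v∈xs with ∈-++⁻ ys₁ (xs⊆ys (there v∈xs))
  ... | inj₁ v∈ys₁         = ∈-++⁺ˡ v∈ys₁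
  ... | inj₂ (here refl)   = ⊥-elim (All.lookup x∉xs v∈xs refl)
  ... | inj₂ (there v∈ys₂) = ∈-++⁺ʳ ys₁ v∈ys₂

module _ {A : Set} where

  DistinctPair : List A → A × A → Set
  DistinctPair xs (p , q) = p ∈ xs × q ∈ xs × p ≢ q

  -- Together with the diagonal, ps is a duplicate-free list of pairs over xs, so |ps| + n ≤ n².
  distinctPairs-length≤ : {xs : List A} {ps : List (A × A)} → Unique xs → Unique ps →
    All (DistinctPair xs) ps → length ps ≤ length xs * (length xs ∸ 1)
  distinctPairs-length≤ {xs} {ps} !xs !ps ps-distinct =
    subst (length ps ≤_) n*n∸n≡n*[n∸1] (m+n≤o⇒m≤o∸n (length ps) |ps|+n≤n*n)
    where
    n = length xs
    diagonal : List (A × A)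
    diagonal = map (λ x → x , x) xs

    distinct : ∀ {p} → p ∈ ps → DistinctPair xs p
    distinct = All.lookup ps-distinct

    !ps++diagonal : Unique (ps ++ diagonal)
    !ps++diagonal = Unique.++⁺ !ps (Unique.map⁺ (cong proj₁) !xs) λ where
      (p∈ps , p∈diagonal) → case ∈-map⁻ _ p∈diagonal of λ where
        (x , _ , refl) → proj₂ (proj₂ (distinct p∈ps)) refl

    ps++diagonal⊆xs×xs : ps ++ diagonal ⊆ cartesianProduct xs xs
    ps++diagonal⊆xs×xs p∈ with ∈-++⁻ ps p∈
    ... | inj₁ p∈ps with p∈xs , q∈xs , _ ← distinct p∈ps = ∈-cartesianProduct⁺ p∈xs q∈xs
    ... | inj₂ p∈diagonal with x , x∈xs , refl ← ∈-map⁻ _ p∈diagonal = ∈-cartesianProduct⁺ x∈xs x∈xs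

    |ps|+n≤n*n : length ps + n ≤ n * n
    |ps|+n≤n*n = subst₂ _≤_
      (trans (length-++ ps) (cong (length ps +_) (length-map _ xs)))
      (length-cartesianProduct xs xs)
      (Unique∧⊆⇒length≤ !ps++diagonal ps++diagonal⊆xs×xs)

    n*n∸n≡n*[n∸1] : n * n ∸ n ≡ n * (n ∸ 1)
    n*n∸n≡n*[n∸1] = trans (cong (n * n ∸_) (≡-sym (*-identityʳ n))) (≡-sym (*-distribˡ-∸ n n 1))

module _ {A Z : Set} (Decodes : A × A → Z → Set) where

  EncodedBy : List A → Z → Set
  EncodedBy xs z = ∃[ p ] (DistinctPair xs p × Decodes p z)

  DecodesFunctional : Set
  DecodesFunctional = ∀ p {z z′} → Decodes p z → Decodes p z′ → z ≡ z′

  module _ {xs : List A} where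

    codes : {zs : List Z} → All (EncodedBy xs) zs → List (A × A)
    codes = All.reduce proj₁

    length-codes : {zs : List Z} (encoded : All (EncodedBy xs) zs) → length (codes encoded) ≡ length zs
    length-codes []            = refl
    length-codes (_ ∷ encoded) = cong suc (length-codes encoded)

    codes-distinct : {zs : List Z} (encoded : All (EncodedBy xs) zs) → All (DistinctPair xs) (codes encoded)
    codes-distinct []                      = []
    codes-distinct ((_ , d , _) ∷ encoded) = d ∷ codes-distinct encoded

    codes-unique : DecodesFunctional → {zs : List Z} → Unique zs →
      (encoded : All (EncodedBy xs) zs) → Unique (codes encoded)
    codes-unique functional []           []            = []
    codes-unique functional (z∉zs ∷ !zs) (e ∷ encoded) = fresh z∉zs encoded ∷ codes-unique functional !zs encoded
      where
      fresh : ∀ {zs} → All (_ ≢_) zs → (encoded : All (EncodedBy xs) zs) → All (proj₁ e ≢_) (codes encoded)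
      fresh []             []             = []
      fresh (z≢z′ ∷ z∉zs) (e′ ∷ encoded) =
        (λ { refl → z≢z′ (functional (proj₁ e) (proj₂ (proj₂ e)) (proj₂ (proj₂ e′))) }) ∷ fresh z∉zs encoded

  encoded-length≤ : DecodesFunctional → {xs : List A} {zs : List Z} → Unique xs → Unique zs →
    All (EncodedBy xs) zs → length zs ≤ length xs * (length xs ∸ 1)
  encoded-length≤ functional !xs !zs encoded = subst (_≤ _) (length-codes encoded)
    (distinctPairs-length≤ !xs (codes-unique functional !zs encoded) (codes-distinct encoded))

module _ {A : Set} where

  replicate-++ : ∀ m n (x : A) → replicate m x ++ replicate n x ≡ replicate (m + n) x
  replicate-++ zero    n x = refl
  replicate-++ (suc m) n x = cong (x ∷_) (replicate-++ m n x)

  replicate-++-suc : ∀ m n (x : A) → replicate m x ++ replicate (suc n) x ≡ replicate (suc (m + n)) x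
  replicate-++-suc m n x = trans (replicate-++ m (suc n) x) (cong (λ k → replicate k x) (+-suc m n))

  replicate-∷ʳ : ∀ n (x : A) → replicate (suc n) x ≡ replicate n x ++ x ∷ []
  replicate-∷ʳ zero    x = refl
  replicate-∷ʳ (suc n) x = cong (x ∷_) (replicate-∷ʳ n x)

  ∷ʳ-view : ∀ (x : A) xs → ∃[ ys ] ∃[ y ] (x ∷ xs ≡ ys ++ y ∷ [])
  ∷ʳ-view x []        = [] , x , refl
  ∷ʳ-view x (x′ ∷ xs) with ys , y , eq ← ∷ʳ-view x′ xs = x ∷ ys , y , cong (x ∷_) eq

  spliceLastTwo : List A → List A → List A
  spliceLastTwo xs ys = reverse (drop 2 (reverse xs)) ++ reverse (take 2 (reverse ys))

  spliceLastTwo-++ : ∀ xs ys {x₁ x₂ y₁ y₂ : A} →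
    spliceLastTwo (xs ++ x₁ ∷ x₂ ∷ []) (ys ++ y₁ ∷ y₂ ∷ []) ≡ xs ++ y₁ ∷ y₂ ∷ []
  spliceLastTwo-++ xs ys = cong₂ _++_
    (trans (cong (reverse ∘ drop 2) (reverse-++ xs _)) (reverse-involutive xs))
    (cong (reverse ∘ take 2) (reverse-++ ys _))

module _ {A : Set} (_≟_ : DecidableEquality A) where

  spanRight : ∀ x s → (∃[ j ] (s ≡ replicate j x))
    ⊎ (∃[ j ] ∃[ c ] ∃[ s′ ] (c ≢ x × s ≡ replicate j x ++ c ∷ s′))
  spanRight x [] = inj₁ (0 , refl)
  spanRight x (c ∷ s) with c ≟ x | spanRight x s
  ... | no c≢x  | _                              = inj₂ (0 , c , s , c≢x , refl)
  ... | yes refl | inj₁ (j , refl)               = inj₁ (suc j , refl)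
  ... | yes refl | inj₂ (j , d , s′ , d≢x , refl) = inj₂ (suc j , d , s′ , d≢x , refl)

  spanLeft : ∀ y p → (∃[ j ] (p ≡ replicate j y))
    ⊎ (∃[ j ] ∃[ d ] ∃[ p′ ] (d ≢ y × p ≡ p′ ++ d ∷ replicate j y))
  spanLeft y [] = inj₁ (0 , refl)
  spanLeft y (c ∷ p) with spanLeft y p | c ≟ y
  ... | inj₂ (j , d , p′ , d≢y , refl) | _        = inj₂ (j , d , c ∷ p′ , d≢y , refl)
  ... | inj₁ (j , refl)               | yes refl = inj₁ (suc j , refl)
  ... | inj₁ (j , refl)               | no c≢y   = inj₂ (j , c , [] , c≢y , refl)

module RunLength {Σ : Set} (_≟Σ_ : DecidableEquality Σ) where

  open Strings _≟Σ_
  module ++-Solver = MonoidSolver (++-monoid (Chr Σ))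

  letter : Run → Chr Σ
  letter (run a _) = a

  Canonical : List Run → Set
  Canonical = Linked (λ r r′ → letter r ≢ letter r′)

  canonical-relength : ∀ {a k k′ rs} → Canonical (run a k ∷ rs) → Canonical (run a k′ ∷ rs)
  canonical-relength [-]         = [-]
  canonical-relength (a≢b ∷ rsᶜ) = a≢b ∷ rsᶜ

  consRun : Chr Σ → List Run → List Run
  consRun x [] = run x 0 ∷ []
  consRun x (run y k ∷ rs) with x ≟ y
  ... | yes _ = run y (suc k) ∷ rs
  ... | no  _ = run x 0 ∷ run y k ∷ rs

  rle-∷ : ∀ x xs → rle (x ∷ xs) ≡ consRun x (rle xs)
  rle-∷ x xs with rle xs
  ... | [] = refl
  ... | run y k ∷ rs with x ≟ y
  ...   | yes _ = refl
  ...   | no  _ = refl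

  consRun-≡ : ∀ x k rs → consRun x (run x k ∷ rs) ≡ run x (suc k) ∷ rs
  consRun-≡ x k rs with x ≟ x
  ... | yes _  = refl
  ... | no x≢x = ⊥-elim (x≢x refl)

  consRun-≢ : ∀ {x y} k rs → x ≢ y → consRun x (run y k ∷ rs) ≡ run x 0 ∷ run y k ∷ rs
  consRun-≢ {x} {y} k rs x≢y with x ≟ y
  ... | yes x≡y = ⊥-elim (x≢y x≡y)
  ... | no  _   = refl

  consRun-++ : ∀ x r rs qs → consRun x (r ∷ rs ++ qs) ≡ consRun x (r ∷ rs) ++ qs
  consRun-++ x (run y k) rs qs with x ≟ y
  ... | yes _ = refl
  ... | no  _ = refl

  consRun-head : ∀ x rs → ∃[ k ] ∃[ rs′ ] (consRun x rs ≡ run x k ∷ rs′)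
  consRun-head x [] = 0 , [] , refl
  consRun-head x (run y k ∷ rs) with x ≟ y
  ... | yes refl = suc k , rs , refl
  ... | no  _    = 0 , run y k ∷ rs , refl

  length-consRun : ∀ x rs → length (consRun x rs) ≤ suc (length rs)
  length-consRun x [] = ≤-refl
  length-consRun x (run y k ∷ rs) with x ≟ y
  ... | yes _ = n≤1+n _
  ... | no  _ = ≤-refl

  canonical-consRun : ∀ x {rs} → Canonical rs → Canonical (consRun x rs)
  canonical-consRun x []                  = [-]
  canonical-consRun x {run y k ∷ rs} rsᶜ with x ≟ y
  ... | yes _   = canonical-relength rsᶜ
  ... | no  x≢y = x≢y ∷ rsᶜ

  expand-consRun : ∀ x rs → expand (consRun x rs) ≡ x ∷ expand rs
  expand-consRun x [] = refl
  expand-consRun x (run y k ∷ rs) with x ≟ y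
  ... | yes refl = refl
  ... | no  _    = refl

  canonical-rle : ∀ xs → Canonical (rle xs)
  canonical-rle []       = []
  canonical-rle (x ∷ xs) = subst Canonical (≡-sym (rle-∷ x xs)) (canonical-consRun x (canonical-rle xs))

  expand-rle : ∀ xs → expand (rle xs) ≡ xs
  expand-rle []       = refl
  expand-rle (x ∷ xs) = begin
    expand (rle (x ∷ xs))      ≡⟨ cong expand (rle-∷ x xs) ⟩
    expand (consRun x (rle xs)) ≡⟨ expand-consRun x (rle xs) ⟩
    x ∷ expand (rle xs)        ≡⟨ cong (x ∷_) (expand-rle xs) ⟩
    x ∷ xs                     ∎
    where
      open ≡-Reasoning

  consRun-letters : ∀ {P : Chr Σ → Set} {x rs} → P x → All (P ∘ letter) rs → All (P ∘ letter) (consRun x rs)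
  consRun-letters {x = x} {[]}           px []         = px ∷ []
  consRun-letters {x = x} {run y k ∷ rs} px (py ∷ prs) with x ≟ y
  ... | yes _ = py ∷ prs
  ... | no  _ = px ∷ py ∷ prs

  rle-letters : ∀ {P : Chr Σ → Set} {xs} → All P xs → All (P ∘ letter) (rle xs)
  rle-letters {xs = []}     []         = []
  rle-letters {xs = x ∷ xs} (px ∷ pxs) = subst (All _) (≡-sym (rle-∷ x xs)) (consRun-letters px (rle-letters pxs))

  R≤length : ∀ xs → R xs ≤ length xs
  R≤length []       = z≤n
  R≤length (x ∷ xs) = begin
    length (rle (x ∷ xs))       ≡⟨ cong length (rle-∷ x xs) ⟩
    length (consRun x (rle xs)) ≤⟨ length-consRun x (rle xs) ⟩
    suc (R xs)                  ≤⟨ s≤s (R≤length xs) ⟩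
    suc (length xs)             ∎
    where
      open ≤-Reasoning

  rle-head : ∀ x xs → ∃[ k ] ∃[ rs ] (rle (x ∷ xs) ≡ run x k ∷ rs)
  rle-head x xs with k , rs , eq ← consRun-head x (rle xs) = k , rs , trans (rle-∷ x xs) eq

  consRun-fresh : ∀ {x k rs} → Canonical (run x k ∷ rs) → consRun x rs ≡ run x 0 ∷ rs
  consRun-fresh {rs = []}           _         = refl
  consRun-fresh {rs = run y l ∷ rs} (x≢y ∷ _) = consRun-≢ l rs x≢y

  rle-replicate-++ : ∀ {a} k xs → Canonical (run a k ∷ rle xs) →
    rle (replicate (suc k) a ++ xs) ≡ run a k ∷ rle xs
  rle-replicate-++ {a} zero xs rsᶜ = trans (rle-∷ a xs) (consRun-fresh rsᶜ)
  rle-replicate-++ {a} (suc k) xs rsᶜ = begin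
    rle (a ∷ replicate (suc k) a ++ xs)          ≡⟨ rle-∷ a (replicate (suc k) a ++ xs) ⟩
    consRun a (rle (replicate (suc k) a ++ xs)) ≡⟨ cong (consRun a) (rle-replicate-++ k xs (canonical-relength rsᶜ)) ⟩
    consRun a (run a k ∷ rle xs)                ≡⟨ consRun-≡ a k (rle xs) ⟩
    run a (suc k) ∷ rle xs                      ∎
    where
      open ≡-Reasoning

  rle-expand : ∀ {rs} → Canonical rs → rle (expand rs) ≡ rs
  rle-expand []                  = refl
  rle-expand {run a k ∷ rs} rsᶜ =
    trans (rle-replicate-++ k (expand rs) (subst (λ qs → Canonical (run a k ∷ qs)) (≡-sym IH) rsᶜ))
          (cong (run a k ∷_) IH)
    where IH = rle-expand (Linked.tail rsᶜ)

  rle-∷-≢ : ∀ {a y ys vs} → vs ≡ y ∷ ys → a ≢ y → rle (a ∷ vs) ≡ run a 0 ∷ rle vs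
  rle-∷-≢ {a} {y} {ys} refl a≢y with k , rs , eq ← rle-head y ys = begin
    rle (a ∷ y ∷ ys)           ≡⟨ rle-∷ a (y ∷ ys) ⟩
    consRun a (rle (y ∷ ys))   ≡⟨ cong (consRun a) eq ⟩
    consRun a (run y k ∷ rs)   ≡⟨ consRun-≢ k rs a≢y ⟩
    run a 0 ∷ run y k ∷ rs     ≡⟨ cong (run a 0 ∷_) eq ⟨
    run a 0 ∷ rle (y ∷ ys)     ∎
    where
      open ≡-Reasoning

  rle-∷ʳ-nonempty : ∀ xs x → ∃[ r ] ∃[ rs ] (rle (xs ++ x ∷ []) ≡ r ∷ rs)
  rle-∷ʳ-nonempty []       x = run x 0 , [] , refl
  rle-∷ʳ-nonempty (y ∷ xs) x with k , rs , eq ← rle-head y (xs ++ x ∷ []) = run y k , rs , eq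

  rle-∷ʳ-≢ : ∀ {b x xs vs} → vs ≡ xs ++ x ∷ [] → x ≢ b → rle (vs ++ b ∷ []) ≡ rle vs ++ run b 0 ∷ []
  rle-∷ʳ-≢ {b} {xs = []} refl x≢b = rle-∷-≢ {ys = []} refl x≢b
  rle-∷ʳ-≢ {b} {x} {y ∷ xs} refl x≢b with r , rs , eq ← rle-∷ʳ-nonempty xs x = begin
    rle (y ∷ (xs ++ x ∷ []) ++ b ∷ [])               ≡⟨ rle-∷ y ((xs ++ x ∷ []) ++ b ∷ []) ⟩
    consRun y (rle ((xs ++ x ∷ []) ++ b ∷ []))        ≡⟨ cong (consRun y) (rle-∷ʳ-≢ {xs = xs} refl x≢b) ⟩
    consRun y (rle (xs ++ x ∷ []) ++ run b 0 ∷ [])    ≡⟨ cong (λ rs → consRun y (rs ++ run b 0 ∷ [])) eq ⟩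
    consRun y (r ∷ rs ++ run b 0 ∷ [])                ≡⟨ consRun-++ y r rs (run b 0 ∷ []) ⟩
    consRun y (r ∷ rs) ++ run b 0 ∷ []                ≡⟨ cong (λ rs → consRun y rs ++ run b 0 ∷ []) eq ⟨
    consRun y (rle (xs ++ x ∷ [])) ++ run b 0 ∷ []    ≡⟨ cong (_++ run b 0 ∷ []) (rle-∷ y (xs ++ x ∷ [])) ⟨
    rle (y ∷ xs ++ x ∷ []) ++ run b 0 ∷ []            ∎
    where
      open ≡-Reasoning

  dropLast-++ : ∀ {X : Set} (xs : List X) y ys → dropLast (xs ++ y ∷ ys) ≡ xs ++ dropLast (y ∷ ys)
  dropLast-++ []            y ys = refl
  dropLast-++ (x ∷ [])      y ys = refl
  dropLast-++ (x ∷ x′ ∷ xs) y ys = cong (x ∷_) (dropLast-++ (x′ ∷ xs) y ys)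

  setLast1-++ : ∀ rs r rs′ → setLast1 (rs ++ r ∷ rs′) ≡ rs ++ setLast1 (r ∷ rs′)
  setLast1-++ []                 r rs′ = refl
  setLast1-++ (run _ _ ∷ [])      r rs′ = refl
  setLast1-++ (run a k ∷ q′ ∷ rs) r rs′ = cong (run a k ∷_) (setLast1-++ (q′ ∷ rs) r rs′)

  shorten-∷-∷ʳ : ∀ y i mid x l → shorten (run y i ∷ mid ++ run x l ∷ []) ≡ run y 0 ∷ mid ++ run x 0 ∷ []
  shorten-∷-∷ʳ y i []              x l = refl
  shorten-∷-∷ʳ y i (run a k ∷ mid) x l = cong (run y 0 ∷_) (setLast1-++ (run a k ∷ mid) (run x l) [])

  sup1-runs : ∀ {W a k y i mid x l b m} → rle W ≡ run a k ∷ run y i ∷ mid ++ run x l ∷ run b m ∷ [] →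
    sup1 W ≡ expand (run y 0 ∷ mid ++ run x 0 ∷ [])
  sup1-runs {W} {y = y} {i} {mid} {x} {l} {b} {m} eq
    -- the rewrites turn R W into 2 + (2 + |mid|), which decides the test R W ≤ᵇ 2
    rewrite eq | length-++ mid {run x l ∷ run b m ∷ []} | +-comm (length mid) 2 =
    cong expand (trans (cong shorten (dropLast-++ (run y i ∷ mid) (run x l) (run b m ∷ [])))
                       (shorten-∷-∷ʳ y i mid x l))

  expand-++ : ∀ rs rs′ → expand (rs ++ rs′) ≡ expand rs ++ expand rs′
  expand-++ []             rs′ = refl
  expand-++ (run a k ∷ rs) rs′ = trans (cong (replicate (suc k) a ++_) (expand-++ rs rs′))
    (≡-sym (++-assoc (replicate (suc k) a) (expand rs) (expand rs′)))

  rle-border : ∀ {a b x y xs ys vs} → vs ≡ y ∷ ys → vs ≡ xs ++ x ∷ [] → a ≢ y → x ≢ b →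
    rle (a ∷ vs ++ b ∷ []) ≡ run a 0 ∷ rle vs ++ run b 0 ∷ []
  rle-border {b = b} vs≡y∷ys vs≡xs∷ʳx a≢y x≢b =
    trans (rle-∷-≢ (cong (_++ b ∷ []) vs≡y∷ys) a≢y) (cong (run _ 0 ∷_) (rle-∷ʳ-≢ vs≡xs∷ʳx x≢b))

  split-bordered : ∀ {W a b} rs → rle W ≡ run a 0 ∷ rs ++ run b 0 ∷ [] → 4 ≤ R W →
    ∃[ r ] ∃[ mid ] ∃[ r′ ] (rle W ≡ run a 0 ∷ r ∷ mid ++ r′ ∷ run b 0 ∷ [])
  split-bordered []       eq 4≤R = case subst (4 ≤_) (cong length eq) 4≤R of λ { (s≤s (s≤s ())) }
  split-bordered (_ ∷ []) eq 4≤R = case subst (4 ≤_) (cong length eq) 4≤R of λ { (s≤s (s≤s (s≤s ()))) }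
  split-bordered {a = a} {b} (r ∷ r₁ ∷ rs) eq _ with mid , r′ , r₁∷rs≡mid∷ʳr′ ← ∷ʳ-view r₁ rs =
    r , mid , r′ , trans eq (cong (λ qs → run a 0 ∷ r ∷ qs) (begin
      (r₁ ∷ rs) ++ run b 0 ∷ []        ≡⟨ cong (_++ run b 0 ∷ []) r₁∷rs≡mid∷ʳr′ ⟩
      (mid ++ r′ ∷ []) ++ run b 0 ∷ [] ≡⟨ ++-assoc mid (r′ ∷ []) (run b 0 ∷ []) ⟩
      mid ++ r′ ∷ run b 0 ∷ []         ∎))
    where
      open ≡-Reasoning

  bridgeRuns : Chr Σ → Chr Σ → ℕ → List Run → Chr Σ → ℕ → Chr Σ → List Run
  bridgeRuns a y i mid x l b = run a 0 ∷ run y i ∷ mid ++ run x l ∷ run b 0 ∷ []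

  expand-bridgeRuns-∷ʳ : ∀ a y i mid x l b →
    expand (bridgeRuns a y i mid x l b) ≡ (expand (run a 0 ∷ run y i ∷ mid) ++ replicate (suc l) x) ++ b ∷ []
  expand-bridgeRuns-∷ʳ a y i mid x l b =
    trans (expand-++ (run a 0 ∷ run y i ∷ mid) (run x l ∷ run b 0 ∷ []))
          (≡-sym (++-assoc (expand (run a 0 ∷ run y i ∷ mid)) (replicate (suc l) x) (b ∷ [])))

  isBridge-expand : ∀ {a y x b} i mid l → a ≢ y → x ≢ b → IsBridge (expand (bridgeRuns a y i mid x l b))
  isBridge-expand {a} {y} {x} {b} i mid l a≢y x≢b =
    s≤s (s≤s z≤n) , (a , y , _ , refl , a≢y) , (expand P ++ replicate l x , x , b , ends , x≢b)
    where
    P = run a 0 ∷ run y i ∷ mid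
    ends : expand (P ++ run x l ∷ run b 0 ∷ []) ≡ (expand P ++ replicate l x) ++ x ∷ b ∷ []
    ends = begin
      expand (P ++ run x l ∷ run b 0 ∷ [])           ≡⟨ expand-++ P (run x l ∷ run b 0 ∷ []) ⟩
      expand P ++ replicate (suc l) x ++ b ∷ []      ≡⟨ cong (λ xs → expand P ++ xs ++ b ∷ []) (replicate-∷ʳ l x) ⟩
      expand P ++ (replicate l x ++ x ∷ []) ++ b ∷ [] ≡⟨ solve 4 (λ P r x b → P ⊕ ((r ⊕ x) ⊕ b) ⊜ (P ⊕ r) ⊕ (x ⊕ b)) refl
                                                         (expand P) (replicate l x) (x ∷ []) (b ∷ []) ⟩
      (expand P ++ replicate l x) ++ x ∷ b ∷ []      ∎
      where
        open ≡-Reasoning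
        open ++-Solver using (solve; _⊕_; _⊜_)

  canonical-lastLink : ∀ rs {r r′} → Canonical (rs ++ r ∷ r′ ∷ []) → letter r ≢ letter r′
  canonical-lastLink []       rsᶜ = Linked.head rsᶜ
  canonical-lastLink (_ ∷ rs) rsᶜ = canonical-lastLink rs (Linked.tail rsᶜ)

  canonical-replaceLast : ∀ rs {x l l′ q c m} → Canonical (rs ++ run x l ∷ q ∷ []) → x ≢ c →
    Canonical (rs ++ run x l′ ∷ run c m ∷ [])
  canonical-replaceLast []            _            x≢c = x≢c ∷ [-]
  canonical-replaceLast (_ ∷ [])      (r≢x ∷ rsᶜ) x≢c = r≢x ∷ canonical-replaceLast [] rsᶜ x≢c
  canonical-replaceLast (_ ∷ r ∷ rs)  (r≢r ∷ rsᶜ) x≢c = r≢r ∷ canonical-replaceLast (r ∷ rs) rsᶜ x≢c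

  extendRight : ∀ {T e x} v n → (v ++ replicate (suc n) x) ⊑ (T ++ e ∷ []) → x ≢ e →
    ∃[ j ] ∃[ c ] (c ≢ x × (v ++ replicate (suc (n + j)) x ++ c ∷ []) ⊑ (T ++ e ∷ []))
  extendRight {T} {e} {x} v n (p , s , occ) x≢e with spanRight _≟_ x s
  ... | inj₁ (j , refl) = ⊥-elim (x≢e (∷ʳ-injectiveʳ (p ++ v ++ replicate (n + j) x) T (trans endsWith-x occ)))
    where
    endsWith-x : (p ++ v ++ replicate (n + j) x) ++ x ∷ [] ≡ p ++ (v ++ replicate (suc n) x) ++ replicate j x
    endsWith-x = begin
      (p ++ v ++ replicate (n + j) x) ++ x ∷ []        ≡⟨ solve 4 (λ p v r x → (p ⊕ (v ⊕ r)) ⊕ x ⊜ p ⊕ (v ⊕ (r ⊕ x))) refl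
                                                           p v (replicate (n + j) x) (x ∷ []) ⟩
      p ++ v ++ replicate (n + j) x ++ x ∷ []          ≡⟨ cong (λ r → p ++ v ++ r) (replicate-∷ʳ (n + j) x) ⟨
      p ++ v ++ replicate (suc n + j) x                ≡⟨ cong (λ r → p ++ v ++ r) (replicate-++ (suc n) j x) ⟨
      p ++ v ++ replicate (suc n) x ++ replicate j x   ≡⟨ solve 4 (λ p v r r′ → p ⊕ (v ⊕ (r ⊕ r′)) ⊜ p ⊕ ((v ⊕ r) ⊕ r′)) refl
                                                           p v (replicate (suc n) x) (replicate j x) ⟩
      p ++ (v ++ replicate (suc n) x) ++ replicate j x ∎
      where
        open ≡-Reasoning
        open ++-Solver using (solve; _⊕_; _⊜_)
  ... | inj₂ (j , c , s′ , c≢x , refl) = j , c , c≢x , p , s′ , trans extended occ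
    where
    extended : p ++ (v ++ replicate (suc (n + j)) x ++ c ∷ []) ++ s′
             ≡ p ++ (v ++ replicate (suc n) x) ++ replicate j x ++ c ∷ s′
    extended = begin
      p ++ (v ++ replicate (suc n + j) x ++ c ∷ []) ++ s′
        ≡⟨ cong (λ r → p ++ (v ++ r ++ c ∷ []) ++ s′) (replicate-++ (suc n) j x) ⟨
      p ++ (v ++ (replicate (suc n) x ++ replicate j x) ++ c ∷ []) ++ s′
        ≡⟨ solve 6 (λ p v r r′ c s → p ⊕ ((v ⊕ ((r ⊕ r′) ⊕ c)) ⊕ s) ⊜ p ⊕ ((v ⊕ r) ⊕ (r′ ⊕ (c ⊕ s)))) refl
             p v (replicate (suc n) x) (replicate j x) (c ∷ []) s′ ⟩
      p ++ (v ++ replicate (suc n) x) ++ replicate j x ++ c ∷ s′ ∎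
      where
        open ≡-Reasoning
        open ++-Solver using (solve; _⊕_; _⊜_)

  extendLeft : ∀ {T e y} n v → (replicate (suc n) y ++ v) ⊑ (e ∷ T) → y ≢ e →
    ∃[ j ] ∃[ d ] (d ≢ y × (d ∷ replicate (suc (j + n)) y ++ v) ⊑ (e ∷ T))
  extendLeft {T} {e} {y} n v (p , s , occ) y≢e with spanLeft _≟_ y p
  ... | inj₁ (j , refl) = ⊥-elim (y≢e (∷-injectiveˡ (trans startsWith-y occ)))
    where
    startsWith-y : y ∷ replicate (j + n) y ++ v ++ s ≡ replicate j y ++ (replicate (suc n) y ++ v) ++ s
    startsWith-y = begin
      replicate (suc (j + n)) y ++ v ++ s               ≡⟨ cong (_++ v ++ s) (replicate-++-suc j n y) ⟨
      (replicate j y ++ replicate (suc n) y) ++ v ++ s ≡⟨ solve 4 (λ r r′ v s → (r ⊕ r′) ⊕ (v ⊕ s) ⊜ r ⊕ ((r′ ⊕ v) ⊕ s)) refl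
                                                          (replicate j y) (replicate (suc n) y) v s ⟩
      replicate j y ++ (replicate (suc n) y ++ v) ++ s ∎
      where
        open ≡-Reasoning
        open ++-Solver using (solve; _⊕_; _⊜_)
  ... | inj₂ (j , d , p′ , d≢y , refl) = j , d , d≢y , p′ , s , trans extended occ
    where
    extended : p′ ++ (d ∷ replicate (suc (j + n)) y ++ v) ++ s
             ≡ (p′ ++ d ∷ replicate j y) ++ (replicate (suc n) y ++ v) ++ s
    extended = begin
      p′ ++ (d ∷ replicate (suc (j + n)) y ++ v) ++ s
        ≡⟨ cong (λ r → p′ ++ (d ∷ r ++ v) ++ s) (replicate-++-suc j n y) ⟨
      p′ ++ (d ∷ (replicate j y ++ replicate (suc n) y) ++ v) ++ s
        ≡⟨ solve 6 (λ p d r r′ v s → p ⊕ ((d ⊕ ((r ⊕ r′) ⊕ v)) ⊕ s) ⊜ (p ⊕ (d ⊕ r)) ⊕ ((r′ ⊕ v) ⊕ s)) refl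
             p′ (d ∷ []) (replicate j y) (replicate (suc n) y) v s ⟩
      (p′ ++ d ∷ replicate j y) ++ (replicate (suc n) y ++ v) ++ s ∎
      where
        open ≡-Reasoning
        open ++-Solver using (solve; _⊕_; _⊜_)

module MinimalAbsentWords {Σ : Set} (_≟Σ_ : DecidableEquality Σ) where

  open Strings _≟Σ_
  open RunLength _≟Σ_

  sym-injective : ∀ {a b : Σ} → sym a ≡ sym b → a ≡ b
  sym-injective refl = refl

  rle-map-sym-≢$ : ∀ z → All ((_≢ $) ∘ letter) (rle (map sym z))
  rle-map-sym-≢$ z = rle-letters {P = _≢ $} (All.map⁺ (All.tabulate {xs = z} λ _ ()))

  rle-M4 : ∀ {a b} u → 4 ≤ R (map sym (a ∷ u ++ b ∷ [])) →
    (∀ c us → u ≡ c ∷ us → a ≢ c) → (∀ us c → u ≡ us ++ c ∷ [] → b ≢ c) →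
    ∃[ r ] ∃[ mid ] ∃[ r′ ] (rle (map sym (a ∷ u ++ b ∷ [])) ≡ run (sym a) 0 ∷ r ∷ mid ++ r′ ∷ run (sym b) 0 ∷ [])
  rle-M4 {a} {b} [] 4≤R _ _ = case ≤-trans 4≤R (R≤length (sym a ∷ sym b ∷ [])) of λ { (s≤s (s≤s ())) }
  rle-M4 {a} {b} u@(c ∷ cs) 4≤R a≢u₁ b≢uₙ with us , d , u≡us∷ʳd ← ∷ʳ-view c cs =
    split-bordered {W = map sym (a ∷ u ++ b ∷ [])} (rle (map sym u))
      (trans (cong (λ vs → rle (sym a ∷ vs)) (map-++ sym u (b ∷ []))) bordered) 4≤R
    where
    bordered : rle (sym a ∷ map sym u ++ sym b ∷ []) ≡ run (sym a) 0 ∷ rle (map sym u) ++ run (sym b) 0 ∷ []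
    bordered = rle-border refl (trans (cong (map sym) u≡us∷ʳd) (map-++ sym us (d ∷ [])))
      (a≢u₁ c cs refl ∘ sym-injective) (b≢uₙ us d u≡us∷ʳd ∘ ≡-sym ∘ sym-injective)

  Decodes : List (Chr Σ) × List (Chr Σ) → List Σ → Set
  Decodes (k₁ , k₂) z = expand (spliceLastTwo (rle k₁) (rle k₂)) ≡ map sym z

  Decodes-functional : DecodesFunctional Decodes
  Decodes-functional _ d d′ = map-injective sym-injective (trans (≡-sym d) d′)

  module _ (t : List Σ) where

    bridgeRuns∈K : ∀ {a y i mid x l b} → Canonical (bridgeRuns a y i mid x l b) →
      expand (bridgeRuns a y i mid x l b) ⊑ text t →
      InK t (expand (run y 0 ∷ mid ++ run x 0 ∷ [])) (expand (bridgeRuns a y i mid x l b))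
    bridgeRuns∈K {a} {y} {i} {mid} {x} {l} {b} rsᶜ occ =
      (isBridge-expand i mid l (Linked.head rsᶜ) (canonical-lastLink (run a 0 ∷ run y i ∷ mid) rsᶜ) , occ) ,
      sup1-runs {W = expand (bridgeRuns a y i mid x l b)} (rle-expand rsᶜ)

    extendLastRun : ∀ {a y i mid x l b} → Canonical (bridgeRuns a y i mid x l b) →
      (expand (run a 0 ∷ run y i ∷ mid) ++ replicate (suc l) x) ⊑ text t → x ≢ $ →
      ∃[ l′ ] ∃[ c ] (Canonical (bridgeRuns a y i mid x l′ c) × expand (bridgeRuns a y i mid x l′ c) ⊑ text t)
    extendLastRun {a} {y} {i} {mid} {x} {l} rsᶜ occ x≢$
      with j , c , c≢x , occ′ ← extendRight {T = $ ∷ map sym t} (expand (run a 0 ∷ run y i ∷ mid)) l occ x≢$ =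
      l + j , c , canonical-replaceLast (run a 0 ∷ run y i ∷ mid) rsᶜ (c≢x ∘ ≡-sym) ,
      subst (_⊑ text t) (≡-sym (expand-++ (run a 0 ∷ run y i ∷ mid) (run x (l + j) ∷ run c 0 ∷ []))) occ′

    extendFirstRun : ∀ {a y i mid x l b} → Canonical (bridgeRuns a y i mid x l b) →
      (replicate (suc i) y ++ expand (mid ++ run x l ∷ run b 0 ∷ [])) ⊑ text t → y ≢ $ →
      ∃[ i′ ] ∃[ d ] (Canonical (bridgeRuns d y i′ mid x l b) × expand (bridgeRuns d y i′ mid x l b) ⊑ text t)
    extendFirstRun {i = i} (_ ∷ rsᶜ) occ y≢$ with j , d , d≢y , occ′ ← extendLeft i _ occ y≢$ =
      j + i , d , d≢y ∷ canonical-relength rsᶜ , occ′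

    extensionPair : ∀ {a y i mid x l b} → Canonical (bridgeRuns a y i mid x l b) →
      ¬ (expand (bridgeRuns a y i mid x l b) ⊑ text t) →
      (expand (run a 0 ∷ run y i ∷ mid) ++ replicate (suc l) x) ⊑ text t →
      (replicate (suc i) y ++ expand (mid ++ run x l ∷ run b 0 ∷ [])) ⊑ text t →
      x ≢ $ → y ≢ $ →
      ∃[ k₁ ] ∃[ k₂ ] ( InK t (expand (run y 0 ∷ mid ++ run x 0 ∷ [])) k₁
                      × InK t (expand (run y 0 ∷ mid ++ run x 0 ∷ [])) k₂
                      × k₁ ≢ k₂
                      × expand (spliceLastTwo (rle k₁) (rle k₂)) ≡ expand (bridgeRuns a y i mid x l b))
    extensionPair {a} {y} {i} {mid} {x} {l} {b} rsᶜ rs∉T init∈T tail∈T x≢$ y≢$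
      with l′ , c , rs₁ᶜ , k₁∈T ← extendLastRun rsᶜ init∈T x≢$
      with i′ , d , rs₂ᶜ , k₂∈T ← extendFirstRun rsᶜ tail∈T y≢$
      = expand rs₁ , expand rs₂ , bridgeRuns∈K rs₁ᶜ k₁∈T , bridgeRuns∈K rs₂ᶜ k₂∈T , k₁≢k₂ ,
        cong expand (trans (cong₂ spliceLastTwo (rle-expand rs₁ᶜ) (rle-expand rs₂ᶜ)) splice₁₂)
      where
      rs₁ = bridgeRuns a y i mid x l′ c
      rs₂ = bridgeRuns d y i′ mid x l b
      splice₁₂ : spliceLastTwo rs₁ rs₂ ≡ bridgeRuns a y i mid x l b
      splice₁₂ = spliceLastTwo-++ (run a 0 ∷ run y i ∷ mid) (run d 0 ∷ run y i′ ∷ mid)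

      k₁≢k₂ : expand rs₁ ≢ expand rs₂
      k₁≢k₂ k₁≡k₂ = rs∉T (subst (_⊑ text t) (cong expand rs₁≡rs) k₁∈T)
        where
        rs₁≡rs₂ : rs₁ ≡ rs₂
        rs₁≡rs₂ = trans (≡-sym (rle-expand rs₁ᶜ)) (trans (cong rle k₁≡k₂) (rle-expand rs₂ᶜ))
        rs₁≡rs : rs₁ ≡ bridgeRuns a y i mid x l b
        rs₁≡rs = begin
          rs₁                     ≡⟨ spliceLastTwo-++ (run a 0 ∷ run y i ∷ mid) (run a 0 ∷ run y i ∷ mid) ⟨
          spliceLastTwo rs₁ rs₁   ≡⟨ cong (spliceLastTwo rs₁) rs₁≡rs₂ ⟩
          spliceLastTwo rs₁ rs₂   ≡⟨ splice₁₂ ⟩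
          bridgeRuns a y i mid x l b ∎
          where
            open ≡-Reasoning

    IsMAW⇒init-occurs : ∀ {a u b} → IsMAW t (a ∷ u ++ b ∷ []) → Occurs t (a ∷ u)
    IsMAW⇒init-occurs {a} {u} {b} (_ , infixes-occur) = infixes-occur (a ∷ u) ([] , b ∷ [] , refl)
      (s≤s (≤-reflexive (≡-sym (trans (length-++ u) (+-comm (length u) 1)))))

    IsMAW⇒tail-occurs : ∀ {a u b} → IsMAW t (a ∷ u ++ b ∷ []) → Occurs t (u ++ b ∷ [])
    IsMAW⇒tail-occurs {a} {u} {b} (_ , infixes-occur) =
      infixes-occur (u ++ b ∷ []) (a ∷ [] , [] , cong (a ∷_) (++-identityʳ (u ++ b ∷ []))) ≤-refl

    M4-encoding : ∀ {w z} → InM4 t z → sup1 (map sym z) ≡ w →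
      ∃[ k₁ ] ∃[ k₂ ] (InK t w k₁ × InK t w k₂ × k₁ ≢ k₂ × Decodes (k₁ , k₂) z)
    M4-encoding {w} (z∈MAW , a , u , b , refl , 4≤R , a≢u₁ , b≢uₙ) z¹≡w
      with run y i , mid , run x l , rle-z ← rle-M4 u 4≤R a≢u₁ b≢uₙ =
      let k₁ , k₂ , k₁∈K , k₂∈K , k₁≢k₂ , decodes = extensionPair rsᶜ rs∉T init∈T tail∈T x≢$ y≢$
      in  k₁ , k₂ , subst (λ w → InK t w k₁) core≡w k₁∈K , subst (λ w → InK t w k₂) core≡w k₂∈K , k₁≢k₂ ,
          trans decodes (≡-sym z≡rs)
      where
      z = a ∷ u ++ b ∷ []
      rs = bridgeRuns (sym a) y i mid x l (sym b)

      z≡rs : map sym z ≡ expand rs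
      z≡rs = trans (≡-sym (expand-rle (map sym z))) (cong expand rle-z)

      rsᶜ : Canonical rs
      rsᶜ = subst Canonical rle-z (canonical-rle (map sym z))

      rs∉T : ¬ (expand rs ⊑ text t)
      rs∉T = proj₁ z∈MAW ∘ subst (_⊑ text t) (≡-sym z≡rs)

      core≡w : expand (run y 0 ∷ mid ++ run x 0 ∷ []) ≡ w
      core≡w = trans (≡-sym (sup1-runs {W = map sym z} rle-z)) z¹≡w

      letters≢$ : All ((_≢ $) ∘ letter) rs
      letters≢$ = subst (All _) rle-z (rle-map-sym-≢$ z)

      y≢$ : y ≢ $
      y≢$ = All.lookup letters≢$ (there (here refl))

      x≢$ : x ≢ $
      x≢$ = All.lookup letters≢$ (there (there (∈-++⁺ʳ mid (here refl))))

      init∈T : (expand (run (sym a) 0 ∷ run y i ∷ mid) ++ replicate (suc l) x) ⊑ text t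
      init∈T = subst (_⊑ text t)
        (∷ʳ-injectiveˡ (map sym (a ∷ u)) _
          (trans (≡-sym (map-++ sym (a ∷ u) (b ∷ []))) (trans z≡rs (expand-bridgeRuns-∷ʳ (sym a) y i mid x l (sym b)))))
        (IsMAW⇒init-occurs z∈MAW)

      tail∈T : (replicate (suc i) y ++ expand (mid ++ run x l ∷ run (sym b) 0 ∷ [])) ⊑ text t
      tail∈T = subst (_⊑ text t) (∷-injectiveʳ z≡rs) (IsMAW⇒tail-occurs z∈MAW)

lemma6 : {Σ : Set} (_≟Σ_ : DecidableEquality Σ) (t : List Σ) → 1 ≤ length t →
    let open Strings _≟Σ_ in
    (w : List (Chr Σ)) → IsBridge w →
    (ks : List (List (Chr Σ))) → Enumerates t ks (InK t w) →
    (zs : List (List Σ)) → Unique zs →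
    All (λ z → InM4 t z × sup1 (map sym z) ≡ w) zs →
    length zs ≤ length ks * (length ks ∸ 1)
lemma6 _≟Σ_ t _ w _ ks (!ks , ks-enumerates-K) zs !zs zs-in-M4 =
  encoded-length≤ Decodes Decodes-functional !ks !zs (All.map encode zs-in-M4)
  where
  open Strings _≟Σ_
  open MinimalAbsentWords _≟Σ_

  encode : ∀ {z} → InM4 t z × sup1 (map sym z) ≡ w → EncodedBy Decodes ks z
  encode (z∈M4 , z¹≡w) with k₁ , k₂ , k₁∈K , k₂∈K , k₁≢k₂ , decodes ← M4-encoding t z∈M4 z¹≡w =
    (k₁ , k₂) , (proj₂ (ks-enumerates-K k₁) k₁∈K , proj₂ (ks-enumerates-K k₂) k₂∈K , k₁≢k₂) , decodes
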